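{- Let $(\varphi_j)_{j\ge 0}$ be non-negative numbers with $\varphi_0>0$. For $n\ge1$ let $T_n=\sum_{T\in\mathcal{O}(n)} \Big(\prod_{v\in T}\varphi_{\mathrm{outdeg}(v)}\Big)\,\ell(T)$, where $\ell(T)$ is the number of increasing bilabellings of $T$ with label set $\{1,\dots,2n\}$. Then \[\sum_{T\in\mathcal{O}(n)}\prod_{v\in T}\left(\frac{\varphi_{\mathrm{outdeg}(v)}}{2h_v(2h_v-1)}\right)=\frac{T_n}{(2n)!}.\]
   Context: $\mathcal{O}(n)$ denotes the set of ordered (planted plane) rooted trees with $n$ nodes; $\mathrm{outdeg}(v)$ is the number of children of $v$. The hook-length $h_v$ of a node $v$ is the number of descendants of $v$ including $v$ itself (the size of the subtree rooted at $v$). An increasing bilabelling of a tree with $n$ nodes assigns to each node a set of exactly two integers from $\{1,\dots,2n\}$, these sets partitioning $\{1,\dots,2n\}$, such that every label of a child is larger than both labels of its parent.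
   Formalization: The numbers $\varphi_j$ are non-negative rationals. -}

module Defs where

open import Data.Nat as ℕ using (ℕ; zero; suc; _∸_; _<ᵇ_; _≡ᵇ_; _!)
open import Data.Nat.Properties using (_!≢0)
open import Data.Bool using (Bool; true; false; _∧_; if_then_else_)
open import Data.List using (List; []; _∷_; map; concatMap; length; upTo; foldr)
import Data.List
open import Data.Integer using (+_)
open import Data.Product using (_×_; _,_)
open import Data.Rational using (ℚ; _*_; _+_; _/_; 0ℚ; 1ℚ)

data Tree : Set where
  node : List Tree → Tree

mutual
  size : Tree → ℕ
  size (node ts) = suc (sizeF ts)

  sizeF : List Tree → ℕ
  sizeF []       = 0
  sizeF (t ∷ ts) = size t ℕ.+ sizeF ts

-- Enumeration of 𝒪(n) (trees with n nodes) and of forests with a given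
-- total number of nodes.  The first argument is fuel, chosen large
-- enough below (fuel 2n+2 suffices for size n).

mutual
  treesF : ℕ → ℕ → List Tree
  treesF zero    _       = []
  treesF (suc f) zero    = []
  treesF (suc f) (suc n) = map node (forestsF f n)

  forestsF : ℕ → ℕ → List (List Tree)
  forestsF zero    _ = []
  forestsF (suc f) zero = [] ∷ []
  forestsF (suc f) (suc n) =
    concatMap (λ k → concatMap (λ t → map (t ∷_) (forestsF f (suc n ∸ suc k)))
                               (treesF f (suc k)))
              (upTo (suc n))

𝒪 : ℕ → List Tree
𝒪 n = treesF (suc (suc (n ℕ.+ n))) n

-- Bilabelled trees: every node carries a pair (a , b), read as the
-- two-element set {a , b} with a < b.

data BTree : Set where
  bnode : ℕ → ℕ → List BTree → BTree

pairs : ℕ → List (ℕ × ℕ)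
pairs N = concatMap (λ a → concatMap (λ b → if a <ᵇ b then (a , b) ∷ [] else [])
                                     (map suc (upTo N)))
                    (map suc (upTo N))

mutual
  allLabellings : ℕ → Tree → List BTree
  allLabellings N (node ts) =
    concatMap (λ p → map (bnode (proj₁ p) (proj₂ p)) (allLabellingsF N ts)) (pairs N)
    where open import Data.Product using (proj₁; proj₂)

  allLabellingsF : ℕ → List Tree → List (List BTree)
  allLabellingsF N []       = [] ∷ []
  allLabellingsF N (t ∷ ts) =
    concatMap (λ b → map (b ∷_) (allLabellingsF N ts)) (allLabellings N t)

mutual
  labels : BTree → List ℕ
  labels (bnode a b cs) = a ∷ b ∷ labelsF cs

  labelsF : List BTree → List ℕ
  labelsF []       = []
  labelsF (c ∷ cs) = labels c Data.List.++ labelsF cs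

countOcc : ℕ → List ℕ → ℕ
countOcc i []       = 0
countOcc i (x ∷ xs) = if i ≡ᵇ x then suc (countOcc i xs) else countOcc i xs

allB : {A : Set} → (A → Bool) → List A → Bool
allB p = foldr (λ x r → p x ∧ r) true

isPartition : ℕ → BTree → Bool
isPartition N B = (length (labels B) ≡ᵇ N) ∧ allB (λ i → countOcc i (labels B) ≡ᵇ 1) (map suc (upTo N))

rootA rootB : BTree → ℕ
rootA (bnode a b _) = a
rootB (bnode a b _) = b

mutual
  isIncreasing : BTree → Bool
  isIncreasing (bnode a b cs) =
    allB (λ c → (a <ᵇ rootA c) ∧ (b <ᵇ rootA c) ∧ (a <ᵇ rootB c) ∧ (b <ᵇ rootB c)) cs
    ∧ isIncreasingF cs

  isIncreasingF : List BTree → Bool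
  isIncreasingF []       = true
  isIncreasingF (c ∷ cs) = isIncreasing c ∧ isIncreasingF cs

countB : {A : Set} → (A → Bool) → List A → ℕ
countB p []       = 0
countB p (x ∷ xs) = if p x then suc (countB p xs) else countB p xs

ℓ : Tree → ℕ
ℓ T = countB (λ B → isPartition (2 ℕ.* size T) B ∧ isIncreasing B)
             (allLabellings (2 ℕ.* size T) T)

sumℚ : List ℚ → ℚ
sumℚ = foldr _+_ 0ℚ

toℚ : ℕ → ℚ
toℚ n = + n / 1

mutual
  weight : (ℕ → ℚ) → Tree → ℚ
  weight φ (node ts) = φ (length ts) * weightF φ ts

  weightF : (ℕ → ℚ) → List Tree → ℚ
  weightF φ []       = 1ℚ
  weightF φ (t ∷ ts) = weight φ t * weightF φ ts

-- 1 / (2h(2h-1)) for h = suc m  (hook lengths are always ≥ 1)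
hookFactor : ℕ → ℚ
hookFactor m = + 1 / ((2 ℕ.* suc m) ℕ.* suc (2 ℕ.* m))

mutual
  hookWeight : (ℕ → ℚ) → Tree → ℚ
  hookWeight φ (node ts) = (φ (length ts) * hookFactor (sizeF ts)) * hookWeightF φ ts

  hookWeightF : (ℕ → ℚ) → List Tree → ℚ
  hookWeightF φ []       = 1ℚ
  hookWeightF φ (t ∷ ts) = hookWeight φ t * hookWeightF φ ts

Tₙ : (ℕ → ℚ) → ℕ → ℚ
Tₙ φ n = sumℚ (map (λ T → weight φ T * toℚ (ℓ T)) (𝒪 n))

Tₙ/[2n]! : (ℕ → ℚ) → ℕ → ℚ
Tₙ/[2n]! φ n = Tₙ φ n * (_/_ (+ 1) ((2 ℕ.* n) !) {{(2 ℕ.* n) !≢0}})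

-- Since hookWeight φ T = weight φ T / ∏_v 2h_v(2h_v − 1), the identity holds tree by tree once
-- ℓ(T) · ∏_v 2h_v(2h_v − 1) = (2n)!. For this, replace {1,…,2n} by an arbitrary set S of available
-- labels: the number of increasing bilabellings of T by distinct labels from S, times the hook
-- product, is the falling factorial (|S|)_{2|T|}. On a forest the count is multiplicative, the first
-- tree taking 2|t| labels of S and the other trees sharing the rest; on a tree whose root carries
-- a < b the subtrees draw their labels from S ∩ (b, ∞), and the sum over a < b in S collapses by two
-- applications of the hockey-stick identity  Σ_{b ∈ S} (|S ∩ (b, ∞)|)_j (j + 1) = (|S|)_{j+1}.

module Submission where

open import Data.Bool using (Bool; true; false; T; not; _∧_; if_then_else_)
open import Data.Bool.Properties using (T-∧; T-≡; ∧-zeroʳ; ∧-identityʳ)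
open import Data.Empty using (⊥-elim)
import Data.Nat as ℕ
open import Data.List using (List; []; _∷_; _++_; map; concatMap; length; upTo; foldl)
open import Data.List.Properties using (length-++; length-map; length-upTo)
open import Data.List.Membership.Propositional using (_∈_; _∉_)
open import Data.List.Membership.DecPropositional ℕ._≟_ using (_∈?_)
open import Data.List.Relation.Unary.All as All using (All; []; _∷_)
import Data.List.Relation.Unary.All.Properties as All
open import Data.List.Relation.Unary.AllPairs as AllPairs using (AllPairs; []; _∷_)
open import Data.List.Relation.Binary.Disjoint.Propositional using (Disjoint)
import Data.List.Relation.Unary.AllPairs.Properties as AllPairs
open import Data.List.Relation.Unary.Any using (here; there)
open import Data.List.Relation.Unary.Unique.Propositional using (Unique)
import Data.List.Relation.Unary.Unique.Propositional.Properties as Unique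
open import Data.Product using (_×_; _,_; proj₁; proj₂)
open import Relation.Nullary using (yes; no; contradiction)
open import Data.Unit using (⊤; tt)
open import Function using (_∘_; Equivalence)
open import Relation.Binary.PropositionalEquality
open import Defs

module Counting where

  open import Data.Nat using (ℕ; zero; suc; _+_; _*_; _∸_; _<ᵇ_; _≡ᵇ_; _<_; _≤_; s<s; _!; _≟_; _≤?_)
  open import Data.Nat.Properties
    using (+-assoc; +-comm; +-identityʳ; +-suc; +-cancelʳ-≡; *-assoc; *-zeroʳ; *-distribʳ-+; *-distribˡ-+; *-suc
          ; ≤-refl; <⇒≤; <⇒≢; <-trans; ≤⇒≯; ≰⇒>; <ᵇ⇒<; <⇒<ᵇ; ≡ᵇ⇒≡; ≡⇒≡ᵇ
          ; suc-injective; m+n∸n≡m; m+[n∸m]≡n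
          ; *-commutativeSemigroup)
  open import Data.Nat.Solver using (module +-*-Solver)
  open +-*-Solver using (solve; _:+_; _:*_; _:=_; con)
  open import Algebra.Properties.CommutativeSemigroup *-commutativeSemigroup using (x∙yz≈xz∙y)
  open ≡-Reasoning

  ∧-split : ∀ x {y} → T (x ∧ y) → T x × T y
  ∧-split x = Equivalence.to (T-∧ {x})

  ∧-join : ∀ {x y} → T x → T y → T (x ∧ y)
  ∧-join Tx Ty = Equivalence.from T-∧ (Tx , Ty)

  T-injective : ∀ {x y} → (T x → T y) → (T y → T x) → x ≡ y
  T-injective {false} {false} _ _ = refl
  T-injective {false} {true}  _ g = ⊥-elim (g tt)
  T-injective {true}  {false} f _ = ⊥-elim (f tt)
  T-injective {true}  {true}  _ _ = refl

  allB⁺ : ∀ {A : Set} (p : A → Bool) {xs} → All (T ∘ p) xs → T (allB p xs)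
  allB⁺ p []         = tt
  allB⁺ p (px ∷ pxs) = ∧-join px (allB⁺ p pxs)

  allB⁻ : ∀ {A : Set} (p : A → Bool) xs → T (allB p xs) → All (T ∘ p) xs
  allB⁻ p []       _ = []
  allB⁻ p (x ∷ xs) t = proj₁ (∧-split (p x) t) ∷ allB⁻ p xs (proj₂ (∧-split (p x) t))

  if-*ʳ : ∀ b x y → (if b then x else 0) * y ≡ (if b then x * y else 0)
  if-*ʳ true  x y = refl
  if-*ʳ false x y = refl

  if-congᵗ : ∀ {A : Set} b {x y z : A} → (T b → x ≡ y) → (if b then x else z) ≡ (if b then y else z)
  if-congᵗ true  x≡y = x≡y tt
  if-congᵗ false _   = refl

  ∑ : {A : Set} → (A → ℕ) → List A → ℕ
  ∑ f []       = 0
  ∑ f (x ∷ xs) = f x + ∑ f xs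

  syntax ∑ (λ x → e) xs = ∑[ x ∈ xs ] e

  module _ {A : Set} where

    ∑-++ : ∀ (f : A → ℕ) xs ys → ∑ f (xs ++ ys) ≡ ∑ f xs + ∑ f ys
    ∑-++ f []       ys = refl
    ∑-++ f (x ∷ xs) ys = trans (cong (f x +_) (∑-++ f xs ys)) (sym (+-assoc (f x) _ _))

    ∑-cong-local : ∀ {f g : A → ℕ} {xs} → All (λ x → f x ≡ g x) xs → ∑ f xs ≡ ∑ g xs
    ∑-cong-local []       = refl
    ∑-cong-local (e ∷ es) = cong₂ _+_ e (∑-cong-local es)

    ∑-cong : ∀ {f g : A → ℕ} → f ≗ g → ∀ xs → ∑ f xs ≡ ∑ g xs
    ∑-cong f≗g xs = ∑-cong-local {xs = xs} (All.tabulate (λ {x} _ → f≗g x))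

    ∑-distribʳ : ∀ (f : A → ℕ) c xs → ∑ f xs * c ≡ ∑[ x ∈ xs ] (f x * c)
    ∑-distribʳ f c []       = refl
    ∑-distribʳ f c (x ∷ xs) = trans (*-distribʳ-+ c (f x) (∑ f xs)) (cong (f x * c +_) (∑-distribʳ f c xs))

    ∑-ifˡ : ∀ c (f : A → ℕ) xs → ∑[ x ∈ xs ] (if c then f x else 0) ≡ (if c then ∑ f xs else 0)
    ∑-ifˡ true  f xs       = refl
    ∑-ifˡ false f []       = refl
    ∑-ifˡ false f (x ∷ xs) = ∑-ifˡ false f xs

    ∑-if : ∀ (P : A → Bool) c xs → ∑[ x ∈ xs ] (if P x then c else 0) ≡ countB P xs * c
    ∑-if P c []       = refl
    ∑-if P c (x ∷ xs) with P x
    ... | true  = cong (c +_) (∑-if P c xs)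
    ... | false = ∑-if P c xs

    countB-++ : ∀ (P : A → Bool) xs ys → countB P (xs ++ ys) ≡ countB P xs + countB P ys
    countB-++ P []       ys = refl
    countB-++ P (x ∷ xs) ys with P x
    ... | true  = cong suc (countB-++ P xs ys)
    ... | false = countB-++ P xs ys

    countB-cong-local : ∀ {P Q : A → Bool} {xs} → All (λ x → P x ≡ Q x) xs → countB P xs ≡ countB Q xs
    countB-cong-local                 []       = refl
    countB-cong-local {Q = Q} {x ∷ _} (e ∷ es) rewrite e with Q x
    ... | true  = cong suc (countB-cong-local es)
    ... | false = countB-cong-local es

    countB-cong : ∀ {P Q : A → Bool} → P ≗ Q → ∀ xs → countB P xs ≡ countB Q xs
    countB-cong P≗Q xs = countB-cong-local {xs = xs} (All.tabulate (λ {x} _ → P≗Q x))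

    countB-skip : ∀ (P : A → Bool) {x} xs → P x ≡ false → countB P (x ∷ xs) ≡ countB P xs
    countB-skip P xs Px≡false rewrite Px≡false = refl

    countB-∧ˡ : ∀ c (P : A → Bool) xs → countB (λ x → c ∧ P x) xs ≡ (if c then countB P xs else 0)
    countB-∧ˡ true  P xs       = refl
    countB-∧ˡ false P []       = refl
    countB-∧ˡ false P (x ∷ xs) = countB-∧ˡ false P xs

    countB-const-true : ∀ (xs : List A) → countB (λ _ → true) xs ≡ length xs
    countB-const-true []       = refl
    countB-const-true (x ∷ xs) = cong suc (countB-const-true xs)

    countB≡0 : ∀ (P : A → Bool) xs → countB P xs ≡ 0 → All (λ x → P x ≡ false) xs
    countB≡0 P []       _ = []
    countB≡0 P (x ∷ xs) e with P x in Px
    ... | false = Px ∷ countB≡0 P xs e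

  module _ {A B : Set} where

    countB-map : ∀ (P : B → Bool) (g : A → B) xs → countB P (map g xs) ≡ countB (P ∘ g) xs
    countB-map P g []       = refl
    countB-map P g (x ∷ xs) with P (g x)
    ... | true  = cong suc (countB-map P g xs)
    ... | false = countB-map P g xs

    countB-concatMap : ∀ (P : B → Bool) (f : A → List B) xs → countB P (concatMap f xs) ≡ ∑[ x ∈ xs ] countB P (f x)
    countB-concatMap P f []       = refl
    countB-concatMap P f (x ∷ xs) = trans (countB-++ P (f x) (concatMap f xs)) (cong (countB P (f x) +_) (countB-concatMap P f xs))

    ∑-concatMap : ∀ (g : B → ℕ) (f : A → List B) xs → ∑ g (concatMap f xs) ≡ ∑[ x ∈ xs ] ∑ g (f x)
    ∑-concatMap g f []       = refl
    ∑-concatMap g f (x ∷ xs) = trans (∑-++ g (f x) (concatMap f xs)) (cong (∑ g (f x) +_) (∑-concatMap g f xs))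

  falling : ℕ → ℕ → ℕ
  falling n       zero    = 1
  falling zero    (suc j) = 0
  falling (suc n) (suc j) = suc n * falling n j

  falling-+ : ∀ m p q → falling m p * falling (m ∸ p) q ≡ falling m (p + q)
  falling-+ m       zero    q = +-identityʳ (falling m q)
  falling-+ zero    (suc p) q = refl
  falling-+ (suc m) (suc p) q = trans (*-assoc (suc m) (falling m p) _) (cong (suc m *_) (falling-+ m p q))

  falling-suc : ∀ m j → falling m (suc j) + j * falling m j ≡ m * falling m j
  falling-suc zero    zero    = refl
  falling-suc zero    (suc j) = *-zeroʳ j
  falling-suc (suc m) zero    = +-identityʳ _
  falling-suc (suc m) (suc j) = begin
      suc m * g + suc j * (suc m * f)   ≡⟨ solve 4 (λ m j f g → (con 1 :+ m) :* g :+ (con 1 :+ j) :* ((con 1 :+ m) :* f)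
                                                       := (con 1 :+ m) :* ((g :+ j :* f) :+ f)) refl m j f g ⟩
      suc m * ((g + j * f) + f)         ≡⟨ cong (λ z → suc m * (z + f)) (falling-suc m j) ⟩
      suc m * (m * f + f)               ≡⟨ cong (suc m *_) (+-comm (m * f) f) ⟩
      suc m * (suc m * f)               ∎
    where
    f = falling m j
    g = falling m (suc j)

  falling-pascal : ∀ m j → falling m j * suc j + falling m (suc j) ≡ falling (suc m) (suc j)
  falling-pascal m j = begin
      f * suc j + g       ≡⟨ solve 3 (λ f g j → f :* (con 1 :+ j) :+ g := f :+ (g :+ j :* f)) refl f g j ⟩
      f + (g + j * f)     ≡⟨ cong (f +_) (falling-suc m j) ⟩
      f + m * f           ∎
    where
    f = falling m j
    g = falling m (suc j)

  falling-diag : ∀ n → falling n n ≡ n !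
  falling-diag zero    = refl
  falling-diag (suc n) = cong (suc n *_) (falling-diag n)

  _∩>_ : (ℕ → Bool) → ℕ → (ℕ → Bool)
  (S ∩> b) x = S x ∧ (b <ᵇ x)

  ∩>-above : ∀ S {b x} → b < x → (S ∩> b) x ≡ S x
  ∩>-above S {b} {x} b<x rewrite Equivalence.to T-≡ (<⇒<ᵇ b<x) = ∧-identityʳ (S x)

  ∩>-below : ∀ S {b x} → x ≤ b → (S ∩> b) x ≡ false
  ∩>-below S {b} {x} x≤b with b <ᵇ x in b<ᵇx
  ... | false = ∧-zeroʳ (S x)
  ... | true  = ⊥-elim (≤⇒≯ x≤b (<ᵇ⇒< b x (Equivalence.from T-≡ b<ᵇx)))

  ∩>-true⇒> : ∀ S {b x} → (S ∩> b) x ≡ true → b < x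
  ∩>-true⇒> S {b} {x} eq with x ≤? b
  ... | yes x≤b = contradiction (trans (sym eq) (∩>-below S x≤b)) λ ()
  ... | no  x≰b = ≰⇒> x≰b

  ∩>-∩> : ∀ S {a b} → a < b → (S ∩> a) ∩> b ≗ S ∩> b
  ∩>-∩> S {a} {b} a<b x with x ≤? b
  ... | yes x≤b = trans (∩>-below (S ∩> a) x≤b) (sym (∩>-below S x≤b))
  ... | no  x≰b = begin
      ((S ∩> a) ∩> b) x  ≡⟨ ∩>-above (S ∩> a) (≰⇒> x≰b) ⟩
      (S ∩> a) x         ≡⟨ ∩>-above S (<-trans a<b (≰⇒> x≰b)) ⟩
      S x                ≡⟨ sym (∩>-above S (≰⇒> x≰b)) ⟩
      (S ∩> b) x         ∎

  -- Classify the ordered (j + 1)-tuples of distinct elements of S by their least element b, which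
  -- has j + 1 possible positions; the other entries form an ordered j-tuple above b.
  hockey-stick : ∀ {V} → AllPairs _<_ V → ∀ S j →
    ∑[ b ∈ V ] (if S b then falling (countB (S ∩> b) V) j * suc j else 0) ≡ falling (countB S V) (suc j)
  hockey-stick {[]}    []               S j = refl
  hockey-stick {u ∷ V} (u<V ∷ V-sorted) S j = begin
      term (u ∷ V) u + ∑[ b ∈ V ] term (u ∷ V) b
        ≡⟨ cong₂ _+_ (cong (λ k → if S u then falling k j * suc j else 0) drop-u)
                     (∑-cong-local (All.map drop-u-above u<V)) ⟩
      (if S u then falling (countB S V) j * suc j else 0) + ∑[ b ∈ V ] term V b
        ≡⟨ cong ((if S u then falling (countB S V) j * suc j else 0) +_) (hockey-stick V-sorted S j) ⟩
      (if S u then falling (countB S V) j * suc j else 0) + falling (countB S V) (suc j)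
        ≡⟨ add-u (S u) ⟩
      falling (countB S (u ∷ V)) (suc j) ∎
    where
    term : List ℕ → ℕ → ℕ
    term W b = if S b then falling (countB (S ∩> b) W) j * suc j else 0
    drop-u : countB (S ∩> u) (u ∷ V) ≡ countB S V
    drop-u = trans (countB-skip (S ∩> u) V (∩>-below S ≤-refl)) (countB-cong-local (All.map (∩>-above S) u<V))
    drop-u-above : ∀ {b} → u < b → term (u ∷ V) b ≡ term V b
    drop-u-above {b} u<b =
      cong (λ k → if S b then falling k j * suc j else 0) (countB-skip (S ∩> b) V (∩>-below S (<⇒≤ u<b)))
    add-u : ∀ s → (if s then falling (countB S V) j * suc j else 0) + falling (countB S V) (suc j)
                  ≡ falling (if s then suc (countB S V) else countB S V) (suc j)
    add-u true  = falling-pascal (countB S V) j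
    add-u false = refl

  hockey-stick₂ : ∀ {V} → AllPairs _<_ V → ∀ S j →
    ∑[ a ∈ V ] ∑[ b ∈ V ]
      (if a <ᵇ b then (if S a ∧ S b then falling (countB (S ∩> b) V) j * (suc (suc j) * suc j) else 0) else 0)
      ≡ falling (countB S V) (suc (suc j))
  hockey-stick₂ {V} V-sorted S j = begin
      ∑[ a ∈ V ] ∑[ b ∈ V ] (if a <ᵇ b then (if S a ∧ S b then F b * K else 0) else 0)
        ≡⟨ ∑-cong (λ a → trans (∑-cong (move-S-a-out a) V) (∑-ifˡ (S a) _ V)) V ⟩
      ∑[ a ∈ V ] (if S a then ∑[ b ∈ V ] (if (S ∩> a) b then F b * K else 0) else 0)
        ≡⟨ ∑-cong (λ a → cong (if S a then_else 0) (inner a)) V ⟩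
      ∑[ a ∈ V ] (if S a then falling (countB (S ∩> a) V) (suc j) * suc (suc j) else 0)
        ≡⟨ hockey-stick V-sorted S (suc j) ⟩
      falling (countB S V) (suc (suc j)) ∎
    where
    F : ℕ → ℕ
    F b = falling (countB (S ∩> b) V) j
    K = suc (suc j) * suc j
    move-S-a-out : ∀ a b → (if a <ᵇ b then (if S a ∧ S b then F b * K else 0) else 0)
                      ≡ (if S a then (if (S ∩> a) b then F b * K else 0) else 0)
    move-S-a-out a b with a <ᵇ b | S a | S b
    ... | true  | true  | true  = refl
    ... | true  | true  | false = refl
    ... | true  | false | _     = refl
    ... | false | true  | true  = refl
    ... | false | true  | false = refl
    ... | false | false | _     = refl
    term-a : ∀ a b → (if (S ∩> a) b then F b * K else 0)
                     ≡ (if (S ∩> a) b then falling (countB ((S ∩> a) ∩> b) V) j * suc j else 0) * suc (suc j)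
    term-a a b with (S ∩> a) b in a<b
    ... | false = refl
    ... | true  = begin
        F b * (suc (suc j) * suc j)
          ≡⟨ cong (λ k → falling k j * K) (countB-cong (∩>-∩> S (∩>-true⇒> S a<b)) V) ⟨
        falling (countB ((S ∩> a) ∩> b) V) j * (suc (suc j) * suc j)
          ≡⟨ x∙yz≈xz∙y (falling (countB ((S ∩> a) ∩> b) V) j) (suc (suc j)) (suc j) ⟩
        falling (countB ((S ∩> a) ∩> b) V) j * suc j * suc (suc j) ∎
    inner : ∀ a → ∑[ b ∈ V ] (if (S ∩> a) b then F b * K else 0) ≡ falling (countB (S ∩> a) V) (suc j) * suc (suc j)
    inner a = begin
      ∑[ b ∈ V ] (if (S ∩> a) b then F b * K else 0)  ≡⟨ ∑-cong (term-a a) V ⟩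
      ∑[ b ∈ V ] ((if (S ∩> a) b then falling (countB ((S ∩> a) ∩> b) V) j * suc j else 0) * suc (suc j))
        ≡⟨ ∑-distribʳ _ (suc (suc j)) V ⟨
      ∑[ b ∈ V ] (if (S ∩> a) b then falling (countB ((S ∩> a) ∩> b) V) j * suc j else 0) * suc (suc j)
        ≡⟨ cong (_* suc (suc j)) (hockey-stick V-sorted (S ∩> a) j) ⟩
      falling (countB (S ∩> a) V) (suc j) * suc (suc j) ∎

  [1‥_] : ℕ → List ℕ
  [1‥ N ] = map suc (upTo N)

  [1‥]-sorted : ∀ N → AllPairs _<_ [1‥ N ]
  [1‥]-sorted N = AllPairs.map⁺ (AllPairs.applyUpTo⁺₁ (λ i → i) N (λ i<j _ → s<s i<j))

  [1‥]-unique : ∀ N → Unique [1‥ N ]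
  [1‥]-unique N = AllPairs.map <⇒≢ ([1‥]-sorted N)

  length-[1‥] : ∀ N → length [1‥ N ] ≡ N
  length-[1‥] N = trans (length-map suc (upTo N)) (length-upTo N)

  _─_ : (ℕ → Bool) → ℕ → (ℕ → Bool)
  (S ─ x) y = S y ∧ not (y ≡ᵇ x)

  ─-self : ∀ S x → (S ─ x) x ≡ false
  ─-self S x rewrite Equivalence.to T-≡ (≡⇒≡ᵇ x x refl) = ∧-zeroʳ (S x)

  ─-other : ∀ S {x y} → y ≢ x → (S ─ x) y ≡ S y
  ─-other S {x} {y} y≢x with y ≡ᵇ x in y≡ᵇx
  ... | false = ∧-identityʳ (S y)
  ... | true  = contradiction (≡ᵇ⇒≡ y x (Equivalence.from T-≡ y≡ᵇx)) y≢x

  _∖_ : (ℕ → Bool) → List ℕ → (ℕ → Bool)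
  _∖_ = foldl _─_

  ∖-sound : ∀ S L {y} → T ((S ∖ L) y) → T (S y) × y ∉ L
  ∖-sound S []      t = t , λ ()
  ∖-sound S (x ∷ L) {y} t with ∖-sound (S ─ x) L t
  ... | t′ , y∉L with y ≟ x
  ... | yes refl = contradiction (subst T (─-self S y) t′) λ ()
  ... | no  y≢x  = subst T (─-other S y≢x) t′ , y∉x∷L
    where
    y∉x∷L : y ∉ x ∷ L
    y∉x∷L (here  y≡x) = y≢x y≡x
    y∉x∷L (there y∈L) = y∉L y∈L

  ∖-complete : ∀ S L {y} → T (S y) → y ∉ L → T ((S ∖ L) y)
  ∖-complete S []      t _   = t
  ∖-complete S (x ∷ L) t y∉ = ∖-complete (S ─ x) L (subst T (sym (─-other S (y∉ ∘ here))) t) (y∉ ∘ there)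

  countB-─ : ∀ S {x V} → Unique V → x ∈ V → T (S x) → suc (countB (S ─ x) V) ≡ countB S V
  countB-─ S {x} {_ ∷ V} (x∉V ∷ _) (here refl) Sx
    rewrite ─-self S x | Equivalence.to T-≡ Sx =
      cong suc (countB-cong-local (All.map (λ x≢y → ─-other S (x≢y ∘ sym)) x∉V))
  countB-─ S {x} {v ∷ V} (v∉V ∷ uV) (there x∈V) Sx rewrite ─-other S (λ v≡x → All.lookup v∉V x∈V v≡x) with S v
  ... | true  = cong suc (countB-─ S uV x∈V Sx)
  ... | false = countB-─ S uV x∈V Sx

  countB-∖ : ∀ S {V} L → Unique V → All (_∈ V) L → Unique L → All (T ∘ S) L →
    countB (S ∖ L) V + length L ≡ countB S V
  countB-∖ S []      _  _              _            _         = +-identityʳ _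
  countB-∖ S {V} (x ∷ L) uV (x∈V ∷ L⊆V) (x∉L ∷ uL) (Sx ∷ SL) = begin
      countB ((S ─ x) ∖ L) V + suc (length L)  ≡⟨ +-suc _ (length L) ⟩
      suc (countB ((S ─ x) ∖ L) V + length L)
        ≡⟨ cong suc (countB-∖ (S ─ x) L uV L⊆V uL (All.zipWith S─x (x∉L , SL))) ⟩
      suc (countB (S ─ x) V)                   ≡⟨ countB-─ S uV x∈V Sx ⟩
      countB S V                               ∎
    where
    S─x : ∀ {y} → x ≢ y × T (S y) → T ((S ─ x) y)
    S─x (x≢y , Sy) = subst T (sym (─-other S (x≢y ∘ sym))) Sy

  unique-⊆-length⇒⊇ : ∀ {V L : List ℕ} → Unique V → Unique L → All (_∈ V) L → length L ≡ length V → All (_∈ L) V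
  unique-⊆-length⇒⊇ {V} {L} uV uL L⊆V |L|≡|V| = All.map (λ {i} → ∈-or-∖ i) (countB≡0 (full ∖ L) V nothing-left)
    where
    full : ℕ → Bool
    full _ = true
    nothing-left : countB (full ∖ L) V ≡ 0
    nothing-left = +-cancelʳ-≡ (length L) _ 0 (begin
      countB (full ∖ L) V + length L  ≡⟨ countB-∖ full L uV L⊆V uL (All.tabulate (λ _ → tt)) ⟩
      countB full V                   ≡⟨ countB-const-true V ⟩
      length V                        ≡⟨ |L|≡|V| ⟨
      length L                        ∎)
    ∈-or-∖ : ∀ i → (full ∖ L) i ≡ false → i ∈ L
    ∈-or-∖ i left with i ∈? L
    ... | yes i∈L = i∈L
    ... | no  i∉L = contradiction (subst T left (∖-complete full L tt i∉L)) λ ()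

  unique-++⁻ : ∀ xs {ys : List ℕ} → Unique (xs ++ ys) → Unique xs × Unique ys × Disjoint xs ys
  unique-++⁻ []       u         = [] , u , λ ()
  unique-++⁻ (x ∷ xs) (x∉ ∷ u) with unique-++⁻ xs u
  ... | uxs , uys , disjoint = All.++⁻ˡ xs x∉ ∷ uxs , uys , disjoint′
    where
    disjoint′ : Disjoint (x ∷ xs) _
    disjoint′ (here refl , v∈ys) = All.lookup (All.++⁻ʳ xs x∉) v∈ys refl
    disjoint′ (there v∈xs , v∈ys) = disjoint (v∈xs , v∈ys)

  countOcc-self : ∀ x xs → countOcc x (x ∷ xs) ≡ suc (countOcc x xs)
  countOcc-self x xs rewrite Equivalence.to T-≡ (≡⇒≡ᵇ x x refl) = refl

  countOcc-other : ∀ {i x} xs → i ≢ x → countOcc i (x ∷ xs) ≡ countOcc i xs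
  countOcc-other {i} {x} xs i≢x with i ≡ᵇ x in i≡ᵇx
  ... | false = refl
  ... | true  = contradiction (≡ᵇ⇒≡ i x (Equivalence.from T-≡ i≡ᵇx)) i≢x

  ∉⇒countOcc≡0 : ∀ {x} xs → x ∉ xs → countOcc x xs ≡ 0
  ∉⇒countOcc≡0 []       _  = refl
  ∉⇒countOcc≡0 (y ∷ ys) x∉ = trans (countOcc-other ys (x∉ ∘ here)) (∉⇒countOcc≡0 ys (x∉ ∘ there))

  countOcc≡0⇒∉ : ∀ {x} xs → countOcc x xs ≡ 0 → x ∉ xs
  countOcc≡0⇒∉ {x} (y ∷ ys) occ x∈ with x ≟ y | x∈
  ... | yes refl | _          = contradiction (trans (sym (countOcc-self y ys)) occ) λ ()
  ... | no  x≢y  | here x≡y   = x≢y x≡y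
  ... | no  x≢y  | there x∈ys = countOcc≡0⇒∉ ys (trans (sym (countOcc-other ys x≢y)) occ) x∈ys

  unique⇒countOcc≡1 : ∀ {x xs} → Unique xs → x ∈ xs → countOcc x xs ≡ 1
  unique⇒countOcc≡1 {x} {_ ∷ ys} (x∉ys ∷ _) (here refl) =
    trans (countOcc-self x ys) (cong suc (∉⇒countOcc≡0 ys (λ x∈ys → All.lookup x∉ys x∈ys refl)))
  unique⇒countOcc≡1 {x} {y ∷ ys} (y∉ys ∷ u) (there x∈ys) =
    trans (countOcc-other ys (λ x≡y → All.lookup y∉ys x∈ys (sym x≡y))) (unique⇒countOcc≡1 u x∈ys)

  countOcc≡1⇒unique : ∀ xs → (∀ {x} → x ∈ xs → countOcc x xs ≡ 1) → Unique xs
  countOcc≡1⇒unique []       _    = []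
  countOcc≡1⇒unique (y ∷ ys) once = All.tabulate (λ z∈ys y≡z → y∉ys (subst (_∈ ys) (sym y≡z) z∈ys))
                                  ∷ countOcc≡1⇒unique ys once-in-ys
    where
    y∉ys : y ∉ ys
    y∉ys = countOcc≡0⇒∉ ys (suc-injective (trans (sym (countOcc-self y ys)) (once (here refl))))
    once-in-ys : ∀ {z} → z ∈ ys → countOcc z ys ≡ 1
    once-in-ys {z} z∈ys = trans (sym (countOcc-other ys z≢y)) (once (there z∈ys))
      where
      z≢y : z ≢ y
      z≢y refl = y∉ys z∈ys

  labelsF-All⁻ : ∀ {P : ℕ → Set} cs → All P (labelsF cs) → All (All P ∘ labels) cs
  labelsF-All⁻ []       _  = []
  labelsF-All⁻ (c ∷ cs) Ps = All.++⁻ˡ (labels c) Ps ∷ labelsF-All⁻ cs (All.++⁻ʳ (labels c) Ps)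

  rootsAbove : ℕ → ℕ → BTree → Bool
  rootsAbove a b c = (a <ᵇ rootA c) ∧ (b <ᵇ rootA c) ∧ (a <ᵇ rootB c) ∧ (b <ᵇ rootB c)

  rootsAbove⁺ : ∀ {a b} cs → a < b → All (b <_) (labelsF cs) → T (allB (rootsAbove a b) cs)
  rootsAbove⁺ {a} {b} cs a<b b<L = allB⁺ (rootsAbove a b) (All.map above (labelsF-All⁻ cs b<L))
    where
    above : ∀ {c} → All (b <_) (labels c) → T (rootsAbove a b c)
    above {bnode _ _ _} (b<a′ ∷ b<b′ ∷ _) =
      ∧-join (<⇒<ᵇ (<-trans a<b b<a′)) (∧-join (<⇒<ᵇ b<a′) (∧-join (<⇒<ᵇ (<-trans a<b b<b′)) (<⇒<ᵇ b<b′)))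

  rootsAbove⁻ : ∀ {a b} cs → T (allB (rootsAbove a b) cs) → All (λ c → b < rootA c) cs
  rootsAbove⁻ {a} {b} cs t = All.map (λ {c} → above c) (allB⁻ (rootsAbove a b) cs t)
    where
    above : ∀ c → T (rootsAbove a b c) → b < rootA c
    above c t = <ᵇ⇒< b (rootA c) (proj₁ (∧-split (b <ᵇ rootA c) (proj₂ (∧-split (a <ᵇ rootA c) t))))

  mutual
    Ordered : BTree → Set
    Ordered (bnode a b cs) = a < b × OrderedF cs

    OrderedF : List BTree → Set
    OrderedF []       = ⊤
    OrderedF (c ∷ cs) = Ordered c × OrderedF cs

  mutual
    labels-above : ∀ {x} c → Ordered c → T (isIncreasing c) → x < rootA c → All (x <_) (labels c)
    labels-above (bnode a b cs) (a<b , ord) inc x<a =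
      x<a ∷ x<b ∷ All.map (<-trans x<b) (labelsF-above cs ord (proj₂ inc′) (rootsAbove⁻ cs (proj₁ inc′)))
      where
      x<b = <-trans x<a a<b
      inc′ = ∧-split (allB (rootsAbove a b) cs) inc

    labelsF-above : ∀ {x} cs → OrderedF cs → T (isIncreasingF cs) → All (λ c → x < rootA c) cs → All (x <_) (labelsF cs)
    labelsF-above []       _          _   _              = []
    labelsF-above (c ∷ cs) (oc , ocs) inc (x<c ∷ x<cs) =
      All.++⁺ (labels-above c oc (proj₁ inc′) x<c) (labelsF-above cs ocs (proj₂ inc′) x<cs)
      where inc′ = ∧-split (isIncreasing c) inc

  -- For Ordered B, increasingIn S B says that B is increasing with distinct labels from S, in a form
  -- that makes counting multiplicative: below a root labelled (a , b) the labels come from S above b,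
  -- and each tree of a forest uses what its left siblings left over.
  mutual
    increasingIn : (ℕ → Bool) → BTree → Bool
    increasingIn S (bnode a b cs) = (S a ∧ S b) ∧ increasingInF (S ∩> b) cs

    increasingInF : (ℕ → Bool) → List BTree → Bool
    increasingInF S []       = true
    increasingInF S (c ∷ cs) = increasingIn S c ∧ increasingInF (S ∖ labels c) cs

  DistinctIn : (ℕ → Bool) → List ℕ → Set
  DistinctIn S L = All (T ∘ S) L × Unique L

  mutual
    increasingIn-sound : ∀ S B → Ordered B → T (increasingIn S B) → T (isIncreasing B) × DistinctIn S (labels B)
    increasingIn-sound S (bnode a b cs) (a<b , ord) t
      with ∧-split (S a ∧ S b) t
    ... | Sab , tcs with increasingInF-sound (S ∩> b) cs ord tcs
    ... | inc , S∩>b , unique =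
      ∧-join (rootsAbove⁺ cs a<b b<L) inc ,
      (proj₁ (∧-split (S a) Sab) ∷ proj₂ (∧-split (S a) Sab) ∷ All.map (proj₁ ∘ split) S∩>b) ,
      (<⇒≢ a<b ∷ All.map (<⇒≢ ∘ <-trans a<b) b<L) ∷ All.map <⇒≢ b<L ∷ unique
      where
      split : ∀ {x} → T ((S ∩> b) x) → T (S x) × T (b <ᵇ x)
      split {x} = ∧-split (S x)
      b<L : All (b <_) (labelsF cs)
      b<L = All.map (λ {x} t → <ᵇ⇒< b x (proj₂ (split t))) S∩>b

    increasingInF-sound : ∀ S cs → OrderedF cs → T (increasingInF S cs) → T (isIncreasingF cs) × DistinctIn S (labelsF cs)
    increasingInF-sound S []       _          _ = tt , [] , []
    increasingInF-sound S (c ∷ cs) (oc , ocs) t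
      with increasingIn-sound S c oc (proj₁ (∧-split (increasingIn S c) t))
         | increasingInF-sound (S ∖ labels c) cs ocs (proj₂ (∧-split (increasingIn S c) t))
    ... | inc , Sc , uc | incs , S∖c , ucs =
      ∧-join inc incs ,
      All.++⁺ Sc (All.map (proj₁ ∘ ∖-sound S (labels c)) S∖c) ,
      Unique.++⁺ uc ucs disjoint
      where
      disjoint : Disjoint (labels c) (labelsF cs)
      disjoint (v∈c , v∈cs) = proj₂ (∖-sound S (labels c) (All.lookup S∖c v∈cs)) v∈c

  mutual
    increasingIn-complete : ∀ S B → Ordered B → T (isIncreasing B) → DistinctIn S (labels B) → T (increasingIn S B)
    increasingIn-complete S (bnode a b cs) (a<b , ord) inc (Sa ∷ Sb ∷ SL , _ ∷ _ ∷ uL) =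
      ∧-join (∧-join Sa Sb) (increasingInF-complete (S ∩> b) cs ord (proj₂ inc′) (All.zipWith S∩>b (SL , b<L) , uL))
      where
      inc′ = ∧-split (allB (rootsAbove a b) cs) inc
      b<L : All (b <_) (labelsF cs)
      b<L = labelsF-above cs ord (proj₂ inc′) (rootsAbove⁻ cs (proj₁ inc′))
      S∩>b : ∀ {x} → T (S x) × b < x → T ((S ∩> b) x)
      S∩>b (Sx , b<x) = ∧-join Sx (<⇒<ᵇ b<x)

    increasingInF-complete : ∀ S cs → OrderedF cs → T (isIncreasingF cs) → DistinctIn S (labelsF cs) → T (increasingInF S cs)
    increasingInF-complete S []       _          _   _        = tt
    increasingInF-complete S (c ∷ cs) (oc , ocs) inc (SL , uL)
      with All.++⁻ (labels c) SL | unique-++⁻ (labels c) uL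
    ... | Sc , Scs | uc , ucs , disjoint =
      ∧-join (increasingIn-complete S c oc (proj₁ inc′) (Sc , uc))
             (increasingInF-complete (S ∖ labels c) cs ocs (proj₂ inc′) (All.tabulate S∖c , ucs))
      where
      inc′ = ∧-split (isIncreasing c) inc
      S∖c : ∀ {y} → y ∈ labelsF cs → T ((S ∖ labels c) y)
      S∖c y∈cs = ∖-complete S (labels c) (All.lookup Scs y∈cs) (λ y∈c → disjoint (y∈c , y∈cs))

  mutual
    hookProduct : Tree → ℕ
    hookProduct (node ts) = 2 * suc (sizeF ts) * suc (2 * sizeF ts) * hookProductF ts

    hookProductF : List Tree → ℕ
    hookProductF []       = 1
    hookProductF (t ∷ ts) = hookProduct t * hookProductF ts

  ∑-pairs : ∀ N (g : ℕ × ℕ → ℕ) →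
    ∑ g (pairs N) ≡ ∑[ a ∈ [1‥ N ] ] ∑[ b ∈ [1‥ N ] ] (if a <ᵇ b then g (a , b) else 0)
  ∑-pairs N g = trans (∑-concatMap g _ [1‥ N ])
                      (∑-cong (λ a → trans (∑-concatMap g _ [1‥ N ]) (∑-cong (singleton a) [1‥ N ])) [1‥ N ])
    where
    singleton : ∀ a b → ∑ g (if a <ᵇ b then (a , b) ∷ [] else []) ≡ (if a <ᵇ b then g (a , b) else 0)
    singleton a b with a <ᵇ b
    ... | true  = +-identityʳ (g (a , b))
    ... | false = refl

  module _ (N : ℕ) where

    #_ : (ℕ → Bool) → ℕ
    # S = countB S [1‥ N ]

    #-∖ : ∀ S L → All (_∈ [1‥ N ]) L → DistinctIn S L → # (S ∖ L) ≡ # S ∸ length L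
    #-∖ S L L⊆ (SL , uL) =
      trans (sym (m+n∸n≡m _ (length L))) (cong (_∸ length L) (countB-∖ S L ([1‥]-unique N) L⊆ uL SL))

    ValidPair : ℕ × ℕ → Set
    ValidPair (a , b) = a ∈ [1‥ N ] × b ∈ [1‥ N ] × a < b

    pairs-valid : All ValidPair (pairs N)
    pairs-valid =
      All.concat⁺ (All.map⁺ (All.tabulate λ {a} a∈ → All.concat⁺ (All.map⁺ (All.tabulate λ {b} → valid a b a∈))))
      where
      valid : ∀ a b → a ∈ [1‥ N ] → b ∈ [1‥ N ] → All ValidPair (if a <ᵇ b then (a , b) ∷ [] else [])
      valid a b a∈ b∈ with a <ᵇ b in a<ᵇb
      ... | true  = (a∈ , b∈ , <ᵇ⇒< a b (Equivalence.from T-≡ a<ᵇb)) ∷ []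
      ... | false = []

    Admissible : ℕ → BTree → Set
    Admissible n B = Ordered B × All (_∈ [1‥ N ]) (labels B) × length (labels B) ≡ 2 * n

    AdmissibleF : ℕ → List BTree → Set
    AdmissibleF n cs = OrderedF cs × All (_∈ [1‥ N ]) (labelsF cs) × length (labelsF cs) ≡ 2 * n

    mutual
      allLabellings-admissible : ∀ t → All (Admissible (size t)) (allLabellings N t)
      allLabellings-admissible (node ts) = All.concat⁺ (All.map⁺ (All.map root pairs-valid))
        where
        root : ∀ {p} → ValidPair p → All (Admissible (size (node ts))) (map (bnode (proj₁ p) (proj₂ p)) (allLabellingsF N ts))
        root (a∈ , b∈ , a<b) = All.map⁺ (All.map (λ (ord , range , len) →
          (a<b , ord) , a∈ ∷ b∈ ∷ range , trans (cong (suc ∘ suc) len) (sym (*-suc 2 (sizeF ts))))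
          (allLabellingsF-admissible ts))

      allLabellingsF-admissible : ∀ ts → All (AdmissibleF (sizeF ts)) (allLabellingsF N ts)
      allLabellingsF-admissible []       = (tt , [] , refl) ∷ []
      allLabellingsF-admissible (t ∷ ts) = All.concat⁺ (All.map⁺ (All.map first (allLabellings-admissible t)))
        where
        first : ∀ {c} → Admissible (size t) c → All (AdmissibleF (sizeF (t ∷ ts))) (map (c ∷_) (allLabellingsF N ts))
        first {c} (oc , rc , lc) = All.map⁺ (All.map (λ (ocs , rcs , lcs) →
          (oc , ocs) , All.++⁺ rc rcs ,
          trans (length-++ (labels c)) (trans (cong₂ _+_ lc lcs) (sym (*-distribˡ-+ 2 (size t) (sizeF ts)))))
          (allLabellingsF-admissible ts))

    mutual
      count-increasingIn : ∀ t S → countB (increasingIn S) (allLabellings N t) * hookProduct t ≡ falling (# S) (2 * size t)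
      count-increasingIn (node ts) S = begin
          countB (increasingIn S) (allLabellings N (node ts)) * (K * H)
            ≡⟨ cong (_* (K * H)) (countB-concatMap (increasingIn S) _ (pairs N)) ⟩
          ∑ root (pairs N) * (K * H)
            ≡⟨ ∑-distribʳ root (K * H) (pairs N) ⟩
          ∑[ p ∈ pairs N ] (root p * (K * H))
            ≡⟨ ∑-pairs N _ ⟩
          ∑[ a ∈ [1‥ N ] ] ∑[ b ∈ [1‥ N ] ] (if a <ᵇ b then root (a , b) * (K * H) else 0)
            ≡⟨ ∑-cong (λ a → ∑-cong (λ b → cong (if a <ᵇ b then_else 0) (root-count a b)) [1‥ N ]) [1‥ N ] ⟩
          ∑[ a ∈ [1‥ N ] ] ∑[ b ∈ [1‥ N ] ]
            (if a <ᵇ b then (if S a ∧ S b then falling (# (S ∩> b)) (2 * s) * K′ else 0) else 0)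
            ≡⟨ hockey-stick₂ ([1‥]-sorted N) S (2 * s) ⟩
          falling (# S) (2 + 2 * s)
            ≡⟨ cong (falling (# S)) (*-suc 2 s) ⟨
          falling (# S) (2 * suc s) ∎
        where
        s  = sizeF ts
        F  = allLabellingsF N ts
        H  = hookProductF ts
        K  = 2 * suc s * suc (2 * s)
        K′ = (2 + 2 * s) * suc (2 * s)
        root : ℕ × ℕ → ℕ
        root p = countB (increasingIn S) (map (bnode (proj₁ p) (proj₂ p)) F)
        subforests : ∀ b → countB (increasingInF (S ∩> b)) F * (K * H) ≡ falling (# (S ∩> b)) (2 * s) * K′
        subforests b = begin
          countB (increasingInF (S ∩> b)) F * (K * H)  ≡⟨ x∙yz≈xz∙y (countB (increasingInF (S ∩> b)) F) K H ⟩
          countB (increasingInF (S ∩> b)) F * H * K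
            ≡⟨ cong₂ _*_ (count-increasingInF ts (S ∩> b)) (cong (_* suc (2 * s)) (*-suc 2 s)) ⟩
          falling (# (S ∩> b)) (2 * s) * K′            ∎
        root-count : ∀ a b → root (a , b) * (K * H) ≡ (if S a ∧ S b then falling (# (S ∩> b)) (2 * s) * K′ else 0)
        root-count a b = begin
          root (a , b) * (K * H)
            ≡⟨ cong (_* (K * H)) (trans (countB-map (increasingIn S) (bnode a b) F)
                                        (countB-∧ˡ (S a ∧ S b) (increasingInF (S ∩> b)) F)) ⟩
          (if S a ∧ S b then countB (increasingInF (S ∩> b)) F else 0) * (K * H)
            ≡⟨ if-*ʳ (S a ∧ S b) _ (K * H) ⟩
          (if S a ∧ S b then countB (increasingInF (S ∩> b)) F * (K * H) else 0)
            ≡⟨ cong (if S a ∧ S b then_else 0) (subforests b) ⟩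
          (if S a ∧ S b then falling (# (S ∩> b)) (2 * s) * K′ else 0) ∎

      count-increasingInF : ∀ ts S →
        countB (increasingInF S) (allLabellingsF N ts) * hookProductF ts ≡ falling (# S) (2 * sizeF ts)
      count-increasingInF []       S = refl
      count-increasingInF (t ∷ ts) S = begin
          countB (increasingInF S) (allLabellingsF N (t ∷ ts)) * H
            ≡⟨ cong (_* H) (countB-concatMap (increasingInF S) _ (allLabellings N t)) ⟩
          ∑[ c ∈ allLabellings N t ] countB (increasingInF S) (map (c ∷_) F) * H
            ≡⟨ ∑-distribʳ _ H (allLabellings N t) ⟩
          ∑[ c ∈ allLabellings N t ] (countB (increasingInF S) (map (c ∷_) F) * H)
            ≡⟨ ∑-cong-local (All.map first-tree (allLabellings-admissible t)) ⟩
          ∑[ c ∈ allLabellings N t ] (if increasingIn S c then X * hookProduct t else 0)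
            ≡⟨ ∑-if (increasingIn S) (X * hookProduct t) (allLabellings N t) ⟩
          countB (increasingIn S) (allLabellings N t) * (X * hookProduct t)
            ≡⟨ x∙yz≈xz∙y (countB (increasingIn S) (allLabellings N t)) X (hookProduct t) ⟩
          countB (increasingIn S) (allLabellings N t) * hookProduct t * X
            ≡⟨ cong (_* X) (count-increasingIn t S) ⟩
          falling (# S) (2 * size t) * X
            ≡⟨ falling-+ (# S) (2 * size t) (2 * sizeF ts) ⟩
          falling (# S) (2 * size t + 2 * sizeF ts)
            ≡⟨ cong (falling (# S)) (*-distribˡ-+ 2 (size t) (sizeF ts)) ⟨
          falling (# S) (2 * (size t + sizeF ts)) ∎
        where
        F = allLabellingsF N ts
        H = hookProduct t * hookProductF ts
        X = falling (# S ∸ 2 * size t) (2 * sizeF ts)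
        rest-of-forest : ∀ {c} → Admissible (size t) c → T (increasingIn S c) →
          countB (increasingInF (S ∖ labels c)) F * H ≡ X * hookProduct t
        rest-of-forest {c} (oc , rc , lc) inc = begin
          countB (increasingInF (S ∖ labels c)) F * (hookProduct t * hookProductF ts)
            ≡⟨ x∙yz≈xz∙y (countB (increasingInF (S ∖ labels c)) F) (hookProduct t) (hookProductF ts) ⟩
          countB (increasingInF (S ∖ labels c)) F * hookProductF ts * hookProduct t
            ≡⟨ cong (_* hookProduct t) (count-increasingInF ts (S ∖ labels c)) ⟩
          falling (# (S ∖ labels c)) (2 * sizeF ts) * hookProduct t
            ≡⟨ cong (λ m → falling m (2 * sizeF ts) * hookProduct t)
                    (trans (#-∖ S (labels c) rc (proj₂ (increasingIn-sound S c oc inc))) (cong (# S ∸_) lc)) ⟩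
          X * hookProduct t ∎
        first-tree : ∀ {c} → Admissible (size t) c →
          countB (increasingInF S) (map (c ∷_) F) * H ≡ (if increasingIn S c then X * hookProduct t else 0)
        first-tree {c} adm = begin
          countB (increasingInF S) (map (c ∷_) F) * H
            ≡⟨ cong (_* H) (trans (countB-map (increasingInF S) (c ∷_) F)
                                  (countB-∧ˡ (increasingIn S c) (increasingInF (S ∖ labels c)) F)) ⟩
          (if increasingIn S c then countB (increasingInF (S ∖ labels c)) F else 0) * H
            ≡⟨ if-*ʳ (increasingIn S c) _ H ⟩
          (if increasingIn S c then countB (increasingInF (S ∖ labels c)) F * H else 0)
            ≡⟨ if-congᵗ (increasingIn S c) (rest-of-forest adm) ⟩
          (if increasingIn S c then X * hookProduct t else 0) ∎

    isPartition∧isIncreasing≡increasingIn : ∀ {B} → Ordered B → All (_∈ [1‥ N ]) (labels B) → length (labels B) ≡ N →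
      (isPartition N B ∧ isIncreasing B) ≡ increasingIn (λ _ → true) B
    isPartition∧isIncreasing≡increasingIn {B} ord L⊆ |L|≡N = T-injective to from
      where
      L = labels B
      once? : ℕ → Bool
      once? i = countOcc i L ≡ᵇ 1
      to : T (isPartition N B ∧ isIncreasing B) → T (increasingIn (λ _ → true) B)
      to t = increasingIn-complete _ B ord inc (All.tabulate (λ _ → tt) , countOcc≡1⇒unique L once)
        where
        part = proj₁ (∧-split (isPartition N B) t)
        inc  = proj₂ (∧-split (isPartition N B) t)
        all-once : All (T ∘ once?) [1‥ N ]
        all-once = allB⁻ once? [1‥ N ] (proj₂ (∧-split (length L ≡ᵇ N) part))
        once : ∀ {i} → i ∈ L → countOcc i L ≡ 1
        once i∈L = ≡ᵇ⇒≡ _ 1 (All.lookup all-once (All.lookup L⊆ i∈L))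
      from : T (increasingIn (λ _ → true) B) → T (isPartition N B ∧ isIncreasing B)
      from t with increasingIn-sound _ B ord t
      ... | inc , _ , unique = ∧-join (∧-join (≡⇒≡ᵇ _ N |L|≡N) (allB⁺ once? (All.map once covered))) inc
        where
        covered : All (_∈ L) [1‥ N ]
        covered = unique-⊆-length⇒⊇ ([1‥]-unique N) unique L⊆ (trans |L|≡N (sym (length-[1‥] N)))
        once : ∀ {i} → i ∈ L → T (once? i)
        once i∈L = ≡⇒≡ᵇ _ 1 (unique⇒countOcc≡1 unique i∈L)

  ℓ*hookProduct≡[2n]! : ∀ t → ℓ t * hookProduct t ≡ (2 * size t) !
  ℓ*hookProduct≡[2n]! t = begin
      ℓ t * hookProduct t
        ≡⟨ cong (_* hookProduct t) (countB-cong-local (All.map partition (allLabellings-admissible N t))) ⟩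
      countB (increasingIn (λ _ → true)) (allLabellings N t) * hookProduct t
        ≡⟨ count-increasingIn N t (λ _ → true) ⟩
      falling (countB (λ _ → true) [1‥ N ]) N
        ≡⟨ cong (λ m → falling m N) (trans (countB-const-true [1‥ N ]) (length-[1‥] N)) ⟩
      falling N N
        ≡⟨ falling-diag N ⟩
      N ! ∎
    where
    N = 2 * size t
    partition : ∀ {B} → Admissible N (size t) B → (isPartition N B ∧ isIncreasing B) ≡ increasingIn (λ _ → true) B
    partition (ord , L⊆ , |L|) = isPartition∧isIncreasing≡increasingIn N ord L⊆ |L|

  mutual
    treesF-size : ∀ f n → All (λ t → size t ≡ n) (treesF f n)
    treesF-size zero    n       = []
    treesF-size (suc f) zero    = []
    treesF-size (suc f) (suc n) = All.map⁺ (All.map (cong suc) (forestsF-size f n))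

    forestsF-size : ∀ f n → All (λ ts → sizeF ts ≡ n) (forestsF f n)
    forestsF-size zero    n       = []
    forestsF-size (suc f) zero    = refl ∷ []
    forestsF-size (suc f) (suc n) = All.concat⁺ (All.map⁺ (All.map first-tree-of-size (All.all-upTo (suc n))))
      where
      first-tree-of-size : ∀ {k} → k < suc n →
        All (λ ts → sizeF ts ≡ suc n) (concatMap (λ t → map (t ∷_) (forestsF f (suc n ∸ suc k))) (treesF f (suc k)))
      first-tree-of-size k<n = All.concat⁺ (All.map⁺ (All.map (λ size-t → All.map⁺ (All.map (λ size-ts →
        trans (cong₂ _+_ size-t size-ts) (m+[n∸m]≡n k<n)) (forestsF-size f _))) (treesF-size f _)))

  𝒪-size : ∀ n → All (λ t → size t ≡ n) (𝒪 n)
  𝒪-size n = treesF-size (2 + (n + n)) n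

open Counting using (hookProduct; hookProductF; ℓ*hookProduct≡[2n]!; 𝒪-size)

open import Data.Nat using (ℕ; suc; _≥_; _!; NonZero)
open import Data.Nat.Properties using (_!≢0)
open import Data.Nat.Coprimality using (1-coprimeTo) renaming (sym to coprime-sym)
open import Data.Integer using (+_)
open import Data.Integer.Properties using (pos-*)
open import Data.Rational using (ℚ; mkℚ; 0ℚ; 1ℚ; _≤_; _<_; _*_; _+_; _/_)
open import Data.Rational.Properties
  using (normalize-coprime; *-inverseˡ; *-assoc; *-comm; *-identityʳ; *-zeroˡ; *-distribʳ-+; *-1-commutativeMonoid)
open import Algebra.Bundles using (CommutativeMonoid)
open import Algebra.Properties.CommutativeSemigroup (CommutativeMonoid.commutativeSemigroup *-1-commutativeMonoid)
  using (interchange)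
open ≡-Reasoning

toℚ≡mkℚ : ∀ n → toℚ n ≡ mkℚ (+ n) 0 (coprime-sym (1-coprimeTo n))
toℚ≡mkℚ n = normalize-coprime (coprime-sym (1-coprimeTo n))

toℚ-* : ∀ m n → toℚ (m ℕ.* n) ≡ toℚ m * toℚ n
toℚ-* m n = trans (cong (_/ 1) (pos-* m n)) (sym (cong₂ _*_ (toℚ≡mkℚ m) (toℚ≡mkℚ n)))

1/n*n≡1 : ∀ n .{{_ : NonZero n}} → (+ 1 / n) * toℚ n ≡ 1ℚ
1/n*n≡1 (suc n) = trans (cong₂ _*_ (normalize-coprime (1-coprimeTo (suc n))) (toℚ≡mkℚ (suc n)))
                        (*-inverseˡ (mkℚ (+ suc n) 0 (coprime-sym (1-coprimeTo (suc n)))))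

mutual
  hookWeight*hookProduct : ∀ φ t → hookWeight φ t * toℚ (hookProduct t) ≡ weight φ t
  hookWeight*hookProduct φ (node ts) = begin
      φ k * hookFactor s * hookWeightF φ ts * toℚ (K ℕ.* hookProductF ts)
        ≡⟨ cong (φ k * hookFactor s * hookWeightF φ ts *_) (toℚ-* K (hookProductF ts)) ⟩
      φ k * hookFactor s * hookWeightF φ ts * (toℚ K * toℚ (hookProductF ts))
        ≡⟨ interchange (φ k * hookFactor s) (hookWeightF φ ts) (toℚ K) (toℚ (hookProductF ts)) ⟩
      φ k * hookFactor s * toℚ K * (hookWeightF φ ts * toℚ (hookProductF ts))
        ≡⟨ cong₂ _*_ (trans (*-assoc (φ k) (hookFactor s) (toℚ K)) (cong (φ k *_) (1/n*n≡1 K)))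
                     (hookWeightF*hookProductF φ ts) ⟩
      φ k * 1ℚ * weightF φ ts
        ≡⟨ cong (_* weightF φ ts) (*-identityʳ (φ k)) ⟩
      φ k * weightF φ ts ∎
    where
    k = length ts
    s = sizeF ts
    K = 2 ℕ.* suc s ℕ.* suc (2 ℕ.* s)

  hookWeightF*hookProductF : ∀ φ ts → hookWeightF φ ts * toℚ (hookProductF ts) ≡ weightF φ ts
  hookWeightF*hookProductF φ []       = refl
  hookWeightF*hookProductF φ (t ∷ ts) = begin
      hookWeight φ t * hookWeightF φ ts * toℚ (hookProduct t ℕ.* hookProductF ts)
        ≡⟨ cong (hookWeight φ t * hookWeightF φ ts *_) (toℚ-* (hookProduct t) (hookProductF ts)) ⟩
      hookWeight φ t * hookWeightF φ ts * (toℚ (hookProduct t) * toℚ (hookProductF ts))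
        ≡⟨ interchange (hookWeight φ t) (hookWeightF φ ts) (toℚ (hookProduct t)) (toℚ (hookProductF ts)) ⟩
      hookWeight φ t * toℚ (hookProduct t) * (hookWeightF φ ts * toℚ (hookProductF ts))
        ≡⟨ cong₂ _*_ (hookWeight*hookProduct φ t) (hookWeightF*hookProductF φ ts) ⟩
      weight φ t * weightF φ ts ∎

hookWeight*[2n]! : ∀ φ {n} t → size t ≡ n → hookWeight φ t * toℚ ((2 ℕ.* n) !) ≡ weight φ t * toℚ (ℓ t)
hookWeight*[2n]! φ t refl = begin
    hookWeight φ t * toℚ ((2 ℕ.* size t) !)
      ≡⟨ cong (λ m → hookWeight φ t * toℚ m) (ℓ*hookProduct≡[2n]! t) ⟨
    hookWeight φ t * toℚ (ℓ t ℕ.* hookProduct t)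
      ≡⟨ cong (hookWeight φ t *_) (trans (toℚ-* (ℓ t) (hookProduct t)) (*-comm (toℚ (ℓ t)) _)) ⟩
    hookWeight φ t * (toℚ (hookProduct t) * toℚ (ℓ t))
      ≡⟨ *-assoc (hookWeight φ t) _ _ ⟨
    hookWeight φ t * toℚ (hookProduct t) * toℚ (ℓ t)
      ≡⟨ cong (_* toℚ (ℓ t)) (hookWeight*hookProduct φ t) ⟩
    weight φ t * toℚ (ℓ t) ∎

sumℚ-*ʳ : ∀ {A : Set} (f : A → ℚ) c xs → sumℚ (map f xs) * c ≡ sumℚ (map (λ x → f x * c) xs)
sumℚ-*ʳ f c []       = *-zeroˡ c
sumℚ-*ʳ f c (x ∷ xs) = trans (*-distribʳ-+ c (f x) _) (cong (_+_ (f x * c)) (sumℚ-*ʳ f c xs))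

sumℚ-divide : ∀ {A : Set} (f g : A → ℚ) d .{{_ : NonZero d}} {xs} →
  All (λ x → f x * toℚ d ≡ g x) xs → sumℚ (map f xs) ≡ sumℚ (map g xs) * (+ 1 / d)
sumℚ-divide f g d {xs} fd≡g = sym (trans (sumℚ-*ʳ g (+ 1 / d) xs) (divide-each fd≡g))
  where
  divide : ∀ {x} → f x * toℚ d ≡ g x → g x * (+ 1 / d) ≡ f x
  divide {x} eq = begin
    g x * (+ 1 / d)                ≡⟨ cong (_* (+ 1 / d)) eq ⟨
    f x * toℚ d * (+ 1 / d)        ≡⟨ *-assoc (f x) (toℚ d) (+ 1 / d) ⟩
    f x * (toℚ d * (+ 1 / d))      ≡⟨ cong (f x *_) (trans (*-comm (toℚ d) (+ 1 / d)) (1/n*n≡1 d)) ⟩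
    f x * 1ℚ                       ≡⟨ *-identityʳ (f x) ⟩
    f x                            ∎
  divide-each : ∀ {ys} → All (λ x → f x * toℚ d ≡ g x) ys → sumℚ (map (λ x → g x * (+ 1 / d)) ys) ≡ sumℚ (map f ys)
  divide-each []         = refl
  divide-each (eq ∷ eqs) = cong₂ _+_ (divide eq) (divide-each eqs)

theorem2p3 : (φ : ℕ → ℚ) → (∀ j → 0ℚ ≤ φ j) → 0ℚ < φ 0 →
    (n : ℕ) → n ≥ 1 →
    sumℚ (map (hookWeight φ) (𝒪 n)) ≡ Tₙ/[2n]! φ n
theorem2p3 φ _ _ n _ =
  sumℚ-divide (hookWeight φ) (λ t → weight φ t * toℚ (ℓ t)) ((2 ℕ.* n) !) {{(2 ℕ.* n) !≢0}}
    (All.map (λ {t} → hookWeight*[2n]! φ t) (𝒪-size n))
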